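{- Let $G$ be a graph containing a twin class of size $t$, and let $v$ be one of these $t$ twins. Then $W(G,G-v)\ge t$.
   Context: Graphs are finite and simple. For three pairwise distinct vertices $u,v,w$, $w$ separates $u$ and $v$ if $w$ is adjacent to exactly one of them. Vertices $u,v$ are twins if $u=v$ or no vertex separates them (equivalently, the transposition $(uv)$ is an automorphism). Being twins is an equivalence relation; its classes are twin classes. $G-v$ is the graph obtained from $G$ by deleting the vertex $v$. For non-isomorphic graphs $G,H$, $W(G,H)$ is the minimum number of distinct variables in a first-order sentence over the vocabulary $\{\sim,=\}$ (adjacency and equality) that is true on one of $G,H$ and false on the other. -}

module Defs where

open import Data.Nat using (ℕ; suc; _≟_)
open import Data.Fin using (Fin; punchIn)
open import Data.Bool using (Bool; true; false; T)
open import Data.List using (List; []; _∷_; _++_; filter; deduplicate; length)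
open import Data.List.Relation.Unary.Unique.Propositional using (Unique)
open import Data.List.Membership.Propositional using (_∈_)
open import Data.Maybe using (Maybe; just; nothing)
open import Data.Product using (Σ; _×_; _,_)
open import Data.Sum using (_⊎_)
open import Data.Empty using (⊥)
open import Relation.Nullary using (¬_; yes; no; ¬?)
open import Relation.Binary.PropositionalEquality using (_≡_; _≢_)
open import Function.Bundles using (_⇔_)

record Graph (n : ℕ) : Set where
  field
    adj    : Fin n → Fin n → Bool
    sym    : ∀ i j → adj i j ≡ adj j i
    irrefl : ∀ i → adj i i ≡ false
open Graph public

_─_ : ∀ {m} → Graph (suc m) → Fin (suc m) → Graph m
adj    (G ─ v) i j = adj G (punchIn v i) (punchIn v j)
sym    (G ─ v) i j = sym G (punchIn v i) (punchIn v j)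
irrefl (G ─ v) i   = irrefl G (punchIn v i)

Separates : ∀ {n} → Graph n → Fin n → Fin n → Fin n → Set
Separates G w u v = w ≢ u × w ≢ v × u ≢ v × ¬ (adj G w u ≡ adj G w v)

Twins : ∀ {n} → Graph n → Fin n → Fin n → Set
Twins G u v = u ≡ v ⊎ (∀ w → ¬ Separates G w u v)

TwinClassSize : ∀ {n} → Graph n → Fin n → ℕ → Set
TwinClassSize {n} G v t =
  Σ (List (Fin n)) λ L → Unique L × (∀ w → (w ∈ L) ⇔ Twins G v w) × length L ≡ t

Var : Set
Var = ℕ

data Formula : Set where
  _≐_ : Var → Var → Formula
  _∼_ : Var → Var → Formula
  ¬'_ : Formula → Formula
  _∧'_ : Formula → Formula → Formula
  _∨'_ : Formula → Formula → Formula
  _⇒'_ : Formula → Formula → Formula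
  ∃'   : Var → Formula → Formula
  ∀'   : Var → Formula → Formula

vars : Formula → List Var
vars (x ≐ y) = x ∷ y ∷ []
vars (x ∼ y) = x ∷ y ∷ []
vars (¬' φ) = vars φ
vars (φ ∧' ψ) = vars φ ++ vars ψ
vars (φ ∨' ψ) = vars φ ++ vars ψ
vars (φ ⇒' ψ) = vars φ ++ vars ψ
vars (∃' x φ) = x ∷ vars φ
vars (∀' x φ) = x ∷ vars φ

numVars : Formula → ℕ
numVars φ = length (deduplicate _≟_ (vars φ))

free : Formula → List Var
free (x ≐ y) = x ∷ y ∷ []
free (x ∼ y) = x ∷ y ∷ []
free (¬' φ) = free φ
free (φ ∧' ψ) = free φ ++ free ψ
free (φ ∨' ψ) = free φ ++ free ψ
free (φ ⇒' ψ) = free φ ++ free ψ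
free (∃' x φ) = filter (λ y → ¬? (y ≟ x)) (free φ)
free (∀' x φ) = filter (λ y → ¬? (y ≟ x)) (free φ)

Sentence : Formula → Set
Sentence φ = free φ ≡ []

-- Semantics. Environments are lists of bindings (latest first), so that
-- the empty graph is handled; unbound variables make atoms false
-- (irrelevant for sentences).
Env : ℕ → Set
Env n = List (ℕ × Fin n)

look : ∀ {n} → Env n → Var → Maybe (Fin n)
look [] x = nothing
look ((y , a) ∷ ρ) x with x ≟ y
... | yes _ = just a
... | no  _ = look ρ x

data Both {n} (R : Fin n → Fin n → Set) : Maybe (Fin n) → Maybe (Fin n) → Set where
  both : ∀ {a b} → R a b → Both R (just a) (just b)

Sat : ∀ {n} → Graph n → Env n → Formula → Set
Sat G ρ (x ≐ y) = Both _≡_ (look ρ x) (look ρ y)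
Sat G ρ (x ∼ y) = Both (λ a b → T (adj G a b)) (look ρ x) (look ρ y)
Sat G ρ (¬' φ) = ¬ Sat G ρ φ
Sat G ρ (φ ∧' ψ) = Sat G ρ φ × Sat G ρ ψ
Sat G ρ (φ ∨' ψ) = Sat G ρ φ ⊎ Sat G ρ ψ
Sat G ρ (φ ⇒' ψ) = Sat G ρ φ → Sat G ρ ψ
Sat {n} G ρ (∃' x φ) = Σ (Fin n) λ a → Sat G ((x , a) ∷ ρ) φ
Sat {n} G ρ (∀' x φ) = (a : Fin n) → Sat G ((x , a) ∷ ρ) φ

_⊨_ : ∀ {n} → Graph n → Formula → Set
G ⊨ φ = Sat G [] φ

Distinguishes : ∀ {n m} → Formula → Graph n → Graph m → Set
Distinguishes φ G H = Sentence φ × ((G ⊨ φ × ¬ (H ⊨ φ)) ⊎ (H ⊨ φ × ¬ (G ⊨ φ)))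

module Submission where

-- An Ehrenfeucht–Fraïssé argument. Let L be the twin class of v, |L| = t, and let the
-- formula use a set X of fewer than t variables. Bindings of X in G and in G ─ v are kept
-- related by a partial isomorphism in which every vertex outside L corresponds to itself
-- and twins correspond to twins. Since all vertices outside L see the members of L alike
-- and all pairs of distinct twins are equally adjacent, such bindings satisfy the same
-- atomic formulas. When a quantifier binds a new twin, at most |X| − 1 other variables
-- are bound, so an unused twin remains on the other side even in G ─ v, where L has lost
-- v. Hence G and G ─ v satisfy the same formulas over X.

open import Defs renaming (sym to adj-sym)
open import Data.Nat using (ℕ; suc; z≤n; _≤_; _<_; _≟_)
open import Data.Nat.Properties using (≤-<-trans; <-trans; <⇒≱; ≮⇒≥)
open import Data.Bool using (T) renaming (_≟_ to _≟ᵇ_)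
open import Data.Fin using (Fin; punchIn; punchOut) renaming (_≟_ to _≟ᶠ_)
open import Data.Fin.Properties using (punchIn-injective; punchIn-punchOut)
open import Data.List using (List; []; _∷_; _++_; length; map; filter; mapMaybe; deduplicate)
open import Data.List.Properties using (length-map; length-mapMaybe; filter-notAll)
open import Data.List.Membership.Propositional using (_∈_; _∉_; find)
open import Data.List.Membership.Propositional.Properties
  using (∈-filter⁺; ∈-filter⁻; ∈-map⁺; ∈-deduplicate⁺)
open import Data.List.Relation.Binary.Subset.Propositional using (_⊆_)
open import Data.List.Relation.Binary.Subset.Propositional.Properties
  using (⊆-trans; xs⊆x∷xs; xs⊆xs++ys; xs⊆ys++xs)
open import Data.List.Relation.Unary.All as All using (all?)
open import Data.List.Relation.Unary.All.Properties using (¬All⇒Any¬)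
open import Data.List.Relation.Unary.Any as Any using (here; there)
open import Data.List.Relation.Unary.AllPairs using (_∷_)
open import Data.List.Relation.Unary.Unique.Propositional using (Unique)
open import Data.Maybe using (Maybe; just; nothing)
open import Data.Maybe.Properties using (just-injective)
open import Data.Maybe.Relation.Binary.Pointwise using (Pointwise; just; nothing)
open import Data.Product using (∃; _×_; _,_; proj₁; map₁; map₂)
open import Data.Product.Function.NonDependent.Propositional using (_×-⇔_)
open import Data.Sum using (inj₁; inj₂)
open import Data.Sum.Function.Propositional using (_⊎-⇔_)
open import Function using (_∘_)
open import Function.Bundles using (_⇔_; mk⇔; Equivalence)
open import Function.Related.TypeIsomorphisms using (→-cong-⇔; ¬-cong-⇔)
open import Relation.Binary.Definitions using (DecidableEquality)
open import Relation.Binary.PropositionalEquality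
  using (_≡_; _≢_; refl; sym; trans; cong; subst; module ≡-Reasoning)
open import Relation.Nullary using (¬_; yes; no; ¬?; contradiction)
open import Relation.Nullary.Decidable using (decidable-stable)

open Equivalence using (to; from)

module ListPigeonhole {A : Set} (_≟_ : DecidableEquality A) where
  open import Data.List.Membership.DecPropositional _≟_ using (_∈?_)

  _∖_ : List A → A → List A
  xs ∖ x = filter (λ y → ¬? (y ≟ x)) xs

  ∈-∖⁺ : ∀ {x y xs} → y ∈ xs → y ≢ x → y ∈ xs ∖ x
  ∈-∖⁺ {x} = ∈-filter⁺ (λ y → ¬? (y ≟ x))

  ∈-∖⁻ : ∀ {x y} xs → y ∈ xs ∖ x → y ∈ xs
  ∈-∖⁻ {x} xs = proj₁ ∘ ∈-filter⁻ (λ y → ¬? (y ≟ x)) {xs = xs}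

  length-∖< : ∀ {x xs} → x ∈ xs → length (xs ∖ x) < length xs
  length-∖< {x} {xs} x∈xs =
    filter-notAll (λ y → ¬? (y ≟ x)) xs (Any.map (λ x≡y y≢x → y≢x (sym x≡y)) x∈xs)

  unique-⊆⇒length≤ : ∀ {xs ys : List A} → Unique xs → xs ⊆ ys → length xs ≤ length ys
  unique-⊆⇒length≤ {[]} _ _ = z≤n
  unique-⊆⇒length≤ {x ∷ xs} {ys} (x≢xs ∷ xs!) x∷xs⊆ys =
    ≤-<-trans (unique-⊆⇒length≤ xs! xs⊆ys∖x) (length-∖< (x∷xs⊆ys (here refl)))
    where
    xs⊆ys∖x : xs ⊆ ys ∖ x
    xs⊆ys∖x y∈xs = ∈-∖⁺ (x∷xs⊆ys (there y∈xs)) (All.lookup x≢xs y∈xs ∘ sym)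

  unique-length<⇒∃∉ : ∀ {xs ys : List A} → Unique xs → length ys < length xs →
                      ∃ λ a → a ∈ xs × a ∉ ys
  unique-length<⇒∃∉ {xs} {ys} xs! |ys|<|xs| with all? (_∈? ys) xs
  ... | yes xs⊆ys = contradiction (unique-⊆⇒length≤ xs! (All.lookup xs⊆ys)) (<⇒≱ |ys|<|xs|)
  ... | no xs⊈ys = find (¬All⇒Any¬ (_∈? ys) xs xs⊈ys)

open ListPigeonhole using (unique-length<⇒∃∉)
open ListPigeonhole _≟_ using (_∖_; ∈-∖⁺; ∈-∖⁻; length-∖<)

module _ {A B : Set} (f : A → Maybe B) where

  ∈-mapMaybe⁺ : ∀ {x y xs} → x ∈ xs → f x ≡ just y → y ∈ mapMaybe f xs
  ∈-mapMaybe⁺ {xs = x ∷ _} (here refl) fx≡y rewrite fx≡y = here refl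
  ∈-mapMaybe⁺ {xs = z ∷ _} (there x∈xs) fx≡y with f z
  ... | just _ = there (∈-mapMaybe⁺ x∈xs fx≡y)
  ... | nothing = ∈-mapMaybe⁺ x∈xs fx≡y

  ∈-mapMaybe⁻ : ∀ {y} xs → y ∈ mapMaybe f xs → ∃ λ x → x ∈ xs × f x ≡ just y
  ∈-mapMaybe⁻ (x ∷ xs) y∈ with f x in fx
  ... | nothing = map₂ (map₁ there) (∈-mapMaybe⁻ xs y∈)
  ... | just _ with y∈
  ...   | here refl = x , here refl , fx
  ...   | there y∈′ = map₂ (map₁ there) (∈-mapMaybe⁻ xs y∈′)

otherValues : ∀ {n} → List Var → Env n → Var → List (Fin n)
otherValues X ρ x = mapMaybe (look ρ) (X ∖ x)

module _ {n} {X : List Var} (ρ : Env n) {x : Var} where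

  ∈-otherValues⁺ : ∀ {y a} → y ∈ X → y ≢ x → look ρ y ≡ just a → a ∈ otherValues X ρ x
  ∈-otherValues⁺ y∈X y≢x = ∈-mapMaybe⁺ (look ρ) (∈-∖⁺ y∈X y≢x)

  ∈-otherValues⁻ : ∀ {a} → a ∈ otherValues X ρ x → ∃ λ y → y ∈ X × look ρ y ≡ just a
  ∈-otherValues⁻ = map₂ (map₁ (∈-∖⁻ X)) ∘ ∈-mapMaybe⁻ (look ρ) (X ∖ x)

  length-otherValues< : x ∈ X → length (otherValues X ρ x) < length X
  length-otherValues< x∈X = ≤-<-trans (length-mapMaybe (look ρ) (X ∖ x)) (length-∖< x∈X)

punchIn-surjective : ∀ {n} {i j : Fin (suc n)} → i ≢ j → ∃ λ k → punchIn i k ≡ j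
punchIn-surjective i≢j = punchOut i≢j , punchIn-punchOut i≢j

≡⇔≡-sym : ∀ {A B : Set} {p q : A} {r s : B} → (p ≡ q ⇔ r ≡ s) → (q ≡ p ⇔ s ≡ r)
≡⇔≡-sym p≡q⇔r≡s = mk⇔ (sym ∘ to p≡q⇔r≡s ∘ sym) (sym ∘ from p≡q⇔r≡s ∘ sym)

just-≡⇔ : ∀ {A B : Set} {a c : A} {b d : B} → (just a ≡ just c ⇔ just b ≡ just d) → (a ≡ c ⇔ b ≡ d)
just-≡⇔ eq = mk⇔ (just-injective ∘ to eq ∘ cong just) (just-injective ∘ from eq ∘ cong just)

module _ {A B : Set} {_~_ : A → B → Set} where

  Pointwise-≡-just : ∀ {p q a b} → Pointwise _~_ p q → (∀ {c d} → c ~ d → (c ≡ a ⇔ d ≡ b)) →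
                     (p ≡ just a ⇔ q ≡ just b)
  Pointwise-≡-just nothing _ = mk⇔ (λ ()) (λ ())
  Pointwise-≡-just (just c~d) f =
    mk⇔ (cong just ∘ to (f c~d) ∘ just-injective) (cong just ∘ from (f c~d) ∘ just-injective)

  partnerʳ : ∀ {p q a} → Pointwise _~_ p q → p ≡ just a → ∃ λ b → q ≡ just b × a ~ b
  partnerʳ (just a~b) refl = _ , refl , a~b

  partnerˡ : ∀ {p q b} → Pointwise _~_ p q → q ≡ just b → ∃ λ a → p ≡ just a × a ~ b
  partnerˡ (just a~b) refl = _ , refl , a~b

Both-cong : ∀ {n k} {_~_ : Fin n → Fin k → Set} {R S p q r s} →
            Pointwise _~_ p r → Pointwise _~_ q s → (p ≡ q ⇔ r ≡ s) →
            (∀ {a b c d} → a ~ b → c ~ d → (a ≡ c ⇔ b ≡ d) → R a c ⇔ S b d) →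
            Both R p q ⇔ Both S r s
Both-cong nothing _ _ _ = mk⇔ (λ ()) (λ ())
Both-cong (just _) nothing _ _ = mk⇔ (λ ()) (λ ())
Both-cong (just a~b) (just c~d) eq f =
  mk⇔ (λ { (both Rac) → both (to R⇔S Rac) }) (λ { (both Sbd) → both (from R⇔S Sbd) })
  where R⇔S = f a~b c~d (just-≡⇔ eq)

module _ {n} (G : Graph n) where

  twins⇒adj≡ : ∀ {u w x} → Twins G u w → x ≢ u → x ≢ w → adj G x u ≡ adj G x w
  twins⇒adj≡ (inj₁ refl) _ _ = refl
  twins⇒adj≡ {u} {w} {x} (inj₂ unseparated) x≢u x≢w with u ≟ᶠ w
  ... | yes refl = refl
  ... | no u≢w = decidable-stable (adj G x u ≟ᵇ adj G x w)
                   (λ adj≢ → unseparated x (x≢u , x≢w , u≢w , adj≢))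

  Twins-sym : ∀ {u w} → Twins G u w → Twins G w u
  Twins-sym (inj₁ u≡w) = inj₁ (sym u≡w)
  Twins-sym (inj₂ unseparated) =
    inj₂ λ x (x≢w , x≢u , w≢u , adj≢) → unseparated x (x≢u , x≢w , w≢u ∘ sym , adj≢ ∘ sym)

  Twins-trans : ∀ {u v w} → Twins G u v → Twins G v w → Twins G u w
  Twins-trans (inj₁ refl) tvw = tvw
  Twins-trans tuv (inj₁ refl) = tuv
  Twins-trans {u} {v} {w} tuv@(inj₂ _) tvw@(inj₂ _) =
    inj₂ λ x (x≢u , x≢w , u≢w , adj≢) → adj≢ (adj≡ x≢u x≢w u≢w)
    where
    open ≡-Reasoning
    adj≡ : ∀ {x} → x ≢ u → x ≢ w → u ≢ w → adj G x u ≡ adj G x w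
    adj≡ {x} x≢u x≢w u≢w with x ≟ᶠ v
    ... | no x≢v = trans (twins⇒adj≡ tuv x≢u x≢v) (twins⇒adj≡ tvw x≢v x≢w)
    ... | yes refl = begin
      adj G x u  ≡⟨ adj-sym G x u ⟩
      adj G u x  ≡⟨ twins⇒adj≡ tvw (x≢u ∘ sym) u≢w ⟩
      adj G u w  ≡⟨ adj-sym G u w ⟩
      adj G w u  ≡⟨ twins⇒adj≡ tuv (u≢w ∘ sym) (x≢w ∘ sym) ⟩
      adj G w x  ≡⟨ adj-sym G w x ⟩
      adj G x w  ∎

module TwinClass {n} (G : Graph n) (L : List (Fin n))
  (twins : ∀ {u w} → u ∈ L → w ∈ L → Twins G u w) where

  adj-outside : ∀ {x u w} → x ∉ L → u ∈ L → w ∈ L → adj G x u ≡ adj G x w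
  adj-outside x∉L u∈L w∈L =
    twins⇒adj≡ G (twins u∈L w∈L) (λ { refl → x∉L u∈L }) (λ { refl → x∉L w∈L })

  adj-inside : ∀ {u w u′ w′} → u ∈ L → w ∈ L → u′ ∈ L → w′ ∈ L → u ≢ w → u′ ≢ w′ →
               adj G u w ≡ adj G u′ w′
  adj-inside {u} {w} {u′} {w′} u∈L w∈L u′∈L w′∈L u≢w u′≢w′ with u ≟ᶠ w′
  ... | yes refl = trans (twins⇒adj≡ G (twins w∈L u′∈L) u≢w (u′≢w′ ∘ sym)) (adj-sym G u u′)
  ... | no u≢w′ = begin
    adj G u w    ≡⟨ twins⇒adj≡ G (twins w∈L w′∈L) u≢w u≢w′ ⟩
    adj G u w′   ≡⟨ adj-sym G u w′ ⟩
    adj G w′ u   ≡⟨ twins⇒adj≡ G (twins u∈L u′∈L) (u≢w′ ∘ sym) (u′≢w′ ∘ sym) ⟩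
    adj G w′ u′  ≡⟨ adj-sym G w′ u′ ⟩
    adj G u′ w′  ∎
    where open ≡-Reasoning

record IsBackAndForth {n k} (G : Graph n) (H : Graph k) (X : List Var)
                      (_≋_ : Env n → Env k → Set) : Set where
  field
    ≐-⇔   : ∀ {ρ σ x y} → ρ ≋ σ → x ∈ X → y ∈ X → Sat G ρ (x ≐ y) ⇔ Sat H σ (x ≐ y)
    ∼-⇔   : ∀ {ρ σ x y} → ρ ≋ σ → x ∈ X → y ∈ X → Sat G ρ (x ∼ y) ⇔ Sat H σ (x ∼ y)
    forth : ∀ {ρ σ x} → ρ ≋ σ → x ∈ X → ∀ a → ∃ λ b → ((x , a) ∷ ρ) ≋ ((x , b) ∷ σ)
    back  : ∀ {ρ σ x} → ρ ≋ σ → x ∈ X → ∀ b → ∃ λ a → ((x , a) ∷ ρ) ≋ ((x , b) ∷ σ)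

  private
    ⊆ˡ : ∀ φ ψ → vars φ ++ vars ψ ⊆ X → vars φ ⊆ X
    ⊆ˡ φ ψ = ⊆-trans (xs⊆xs++ys (vars φ) (vars ψ))

    ⊆ʳ : ∀ φ ψ → vars φ ++ vars ψ ⊆ X → vars ψ ⊆ X
    ⊆ʳ φ ψ = ⊆-trans (xs⊆ys++xs (vars ψ) (vars φ))

    ⊆-body : ∀ x φ → x ∷ vars φ ⊆ X → vars φ ⊆ X
    ⊆-body x φ = ⊆-trans (xs⊆x∷xs (vars φ) x)

  Sat-⇔ : ∀ {ρ σ} φ → vars φ ⊆ X → ρ ≋ σ → Sat G ρ φ ⇔ Sat H σ φ
  Sat-⇔ (x ≐ y) xy⊆X R = ≐-⇔ R (xy⊆X (here refl)) (xy⊆X (there (here refl)))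
  Sat-⇔ (x ∼ y) xy⊆X R = ∼-⇔ R (xy⊆X (here refl)) (xy⊆X (there (here refl)))
  Sat-⇔ (¬' φ) φ⊆X R = ¬-cong-⇔ (Sat-⇔ φ φ⊆X R)
  Sat-⇔ (φ ∧' ψ) φψ⊆X R = Sat-⇔ φ (⊆ˡ φ ψ φψ⊆X) R ×-⇔ Sat-⇔ ψ (⊆ʳ φ ψ φψ⊆X) R
  Sat-⇔ (φ ∨' ψ) φψ⊆X R = Sat-⇔ φ (⊆ˡ φ ψ φψ⊆X) R ⊎-⇔ Sat-⇔ ψ (⊆ʳ φ ψ φψ⊆X) R
  Sat-⇔ (φ ⇒' ψ) φψ⊆X R = →-cong-⇔ (Sat-⇔ φ (⊆ˡ φ ψ φψ⊆X) R) (Sat-⇔ ψ (⊆ʳ φ ψ φψ⊆X) R)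
  Sat-⇔ (∃' x φ) xφ⊆X R = mk⇔
    (λ (a , Gφ) → let b , R′ = forth R x∈X a in b , to (Sat-⇔ φ φ⊆X R′) Gφ)
    (λ (b , Hφ) → let a , R′ = back R x∈X b in a , from (Sat-⇔ φ φ⊆X R′) Hφ)
    where x∈X = xφ⊆X (here refl)
          φ⊆X = ⊆-body x φ xφ⊆X
  Sat-⇔ (∀' x φ) xφ⊆X R = mk⇔
    (λ Gφ b → let a , R′ = back R x∈X b in to (Sat-⇔ φ φ⊆X R′) (Gφ a))
    (λ Hφ a → let b , R′ = forth R x∈X a in from (Sat-⇔ φ φ⊆X R′) (Hφ b))
    where x∈X = xφ⊆X (here refl)
          φ⊆X = ⊆-body x φ xφ⊆X

⇔⇒¬Distinguishes : ∀ {n k} {G : Graph n} {H : Graph k} {φ} → G ⊨ φ ⇔ H ⊨ φ → ¬ Distinguishes φ G H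
⇔⇒¬Distinguishes G⇔H (_ , inj₁ (G⊨φ , H⊭φ)) = H⊭φ (to G⇔H G⊨φ)
⇔⇒¬Distinguishes G⇔H (_ , inj₂ (H⊨φ , G⊭φ)) = G⊭φ (from G⇔H H⊨φ)

module TwinDeletion {m} (G : Graph (suc m)) (v : Fin (suc m)) (L : List (Fin (suc m)))
  (L-twins : ∀ {w} → w ∈ L → Twins G v w) (v∈L : v ∈ L) (L! : Unique L)
  (X : List Var) (|X|<|L| : length X < length L) where

  open import Data.List.Membership.DecPropositional (_≟ᶠ_ {suc m}) using (_∈?_)
  open import Data.List.Membership.DecPropositional (_≟ᶠ_ {m}) using () renaming (_∈?_ to _∈ₕ?_)

  H : Graph m
  H = G ─ v

  open TwinClass G L (λ u∈L w∈L → Twins-trans G (Twins-sym G (L-twins u∈L)) (L-twins w∈L))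

  data _≈_ : Fin (suc m) → Fin m → Set where
    outside : ∀ {b} → punchIn v b ∉ L → punchIn v b ≈ b
    inside  : ∀ {a b} → a ∈ L → punchIn v b ∈ L → a ≈ b

  ≈-adj : ∀ {a b c d} → a ≈ b → c ≈ d → (a ≡ c ⇔ b ≡ d) → adj G a c ≡ adj H b d
  ≈-adj (outside _) (outside _) _ = refl
  ≈-adj (outside a∉L) (inside c∈L d∈L) _ = adj-outside a∉L c∈L d∈L
  ≈-adj (inside a∈L b∈L) (outside c∉L) _ =
    trans (adj-sym G _ _) (trans (adj-outside c∉L a∈L b∈L) (adj-sym G _ _))
  ≈-adj {a} {b} {c} {d} (inside a∈L b∈L) (inside c∈L d∈L) a≡c⇔b≡d with a ≟ᶠ c
  ... | yes refl with to a≡c⇔b≡d refl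
  ...   | refl = trans (irrefl G a) (sym (irrefl H b))
  ≈-adj {a} {b} {c} {d} (inside a∈L b∈L) (inside c∈L d∈L) a≡c⇔b≡d | no a≢c =
    adj-inside a∈L c∈L b∈L d∈L a≢c (a≢c ∘ from a≡c⇔b≡d ∘ punchIn-injective v b d)

  outside-≡⇔ : ∀ {b c d} → punchIn v b ∉ L → c ≈ d → (c ≡ punchIn v b ⇔ d ≡ b)
  outside-≡⇔ _ (outside _) = mk⇔ (punchIn-injective v _ _) (cong (punchIn v))
  outside-≡⇔ b∉L (inside c∈L d∈L) =
    mk⇔ (λ { refl → contradiction c∈L b∉L }) (λ { refl → contradiction d∈L b∉L })

  record _≋_ (ρ : Env (suc m)) (σ : Env m) : Set where
    field
      related : ∀ {x} → x ∈ X → Pointwise _≈_ (look ρ x) (look σ x)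
      sameEq  : ∀ {x y} → x ∈ X → y ∈ X → (look ρ x ≡ look ρ y) ⇔ (look σ x ≡ look σ y)
  open _≋_

  []≋[] : [] ≋ []
  related []≋[] _ = nothing
  sameEq  []≋[] _ _ = mk⇔ (λ _ → refl) (λ _ → refl)

  Compatible : Env (suc m) → Env m → Var → Fin (suc m) → Fin m → Set
  Compatible ρ σ x a b = ∀ {y} → y ∈ X → y ≢ x → (look ρ y ≡ just a) ⇔ (look σ y ≡ just b)

  extend : ∀ {ρ σ x a b} → ρ ≋ σ → a ≈ b → Compatible ρ σ x a b → ((x , a) ∷ ρ) ≋ ((x , b) ∷ σ)
  related (extend {x = x} R a≈b _) {z} z∈X with z ≟ x
  ... | yes _ = just a≈b
  ... | no _ = related R z∈X
  sameEq (extend {x = x} R _ compatible) {z} {w} z∈X w∈X with z ≟ x | w ≟ x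
  ... | yes _ | yes _ = mk⇔ (λ _ → refl) (λ _ → refl)
  ... | yes _ | no w≢x = ≡⇔≡-sym (compatible w∈X w≢x)
  ... | no z≢x | yes _ = compatible z∈X z≢x
  ... | no _ | no _ = sameEq R z∈X w∈X

  compatible-outside : ∀ {ρ σ x b} → ρ ≋ σ → punchIn v b ∉ L → Compatible ρ σ x (punchIn v b) b
  compatible-outside R b∉L y∈X _ = Pointwise-≡-just (related R y∈X) (outside-≡⇔ b∉L)

  compatible-reuse : ∀ {ρ σ x a b z} → ρ ≋ σ → z ∈ X → look ρ z ≡ just a → look σ z ≡ just b →
                     Compatible ρ σ x a b
  compatible-reuse R z∈X ρz≡a σz≡b y∈X _ rewrite sym ρz≡a | sym σz≡b = sameEq R y∈X z∈X

  compatible-fresh : ∀ {ρ σ x a b} → a ∉ otherValues X ρ x → b ∉ otherValues X σ x →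
                     Compatible ρ σ x a b
  compatible-fresh {ρ} {σ} a∉ b∉ y∈X y≢x =
    mk⇔ (λ ρy≡a → contradiction (∈-otherValues⁺ ρ y∈X y≢x ρy≡a) a∉)
        (λ σy≡b → contradiction (∈-otherValues⁺ σ y∈X y≢x σy≡b) b∉)

  length-v∷otherValues< : ∀ σ {x} → x ∈ X →
                          length (v ∷ map (punchIn v) (otherValues X σ x)) < length L
  length-v∷otherValues< σ {x} x∈X rewrite length-map (punchIn v) (otherValues X σ x) =
    ≤-<-trans (length-otherValues< σ x∈X) |X|<|L|

  unused-twin : ∀ ρ {x} → x ∈ X → ∃ λ a → a ∈ L × a ∉ otherValues X ρ x
  unused-twin ρ x∈X = unique-length<⇒∃∉ _≟ᶠ_ L! (<-trans (length-otherValues< ρ x∈X) |X|<|L|)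

  unused-twin-G─v : ∀ σ {x} → x ∈ X → ∃ λ b → punchIn v b ∈ L × b ∉ otherValues X σ x
  unused-twin-G─v σ {x} x∈X with unique-length<⇒∃∉ _≟ᶠ_ L! (length-v∷otherValues< σ x∈X)
  ... | e , e∈L , e∉ with punchIn-surjective {i = v} {j = e} (e∉ ∘ here ∘ sym)
  ...   | b , refl = b , e∈L , e∉ ∘ there ∘ ∈-map⁺ (punchIn v)

  forth : ∀ {ρ σ x} → ρ ≋ σ → x ∈ X → ∀ a → ∃ λ b → ((x , a) ∷ ρ) ≋ ((x , b) ∷ σ)
  forth R x∈X a with a ∈? L
  ... | no a∉L with punchIn-surjective {i = v} {j = a} (λ { refl → a∉L v∈L })
  ...   | b , refl = b , extend R (outside a∉L) (compatible-outside R a∉L)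
  forth {ρ} {σ} {x} R x∈X a | yes a∈L with a ∈? otherValues X ρ x
  ... | yes a∈ρ = let y , y∈X , ρy≡a = ∈-otherValues⁻ ρ a∈ρ
                      b , σy≡b , a≈b = partnerʳ (related R y∈X) ρy≡a
                  in b , extend R a≈b (compatible-reuse R y∈X ρy≡a σy≡b)
  ... | no a∉ρ = let b , b∈L , b∉σ = unused-twin-G─v σ x∈X
                 in b , extend R (inside a∈L b∈L) (compatible-fresh {ρ} {σ} a∉ρ b∉σ)

  back : ∀ {ρ σ x} → ρ ≋ σ → x ∈ X → ∀ b → ∃ λ a → ((x , a) ∷ ρ) ≋ ((x , b) ∷ σ)
  back R x∈X b with punchIn v b ∈? L
  ... | no b∉L = punchIn v b , extend R (outside b∉L) (compatible-outside R b∉L)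
  back {ρ} {σ} {x} R x∈X b | yes b∈L with b ∈ₕ? otherValues X σ x
  ... | yes b∈σ = let y , y∈X , σy≡b = ∈-otherValues⁻ σ b∈σ
                      a , ρy≡a , a≈b = partnerˡ (related R y∈X) σy≡b
                  in a , extend R a≈b (compatible-reuse R y∈X ρy≡a σy≡b)
  ... | no b∉σ = let a , a∈L , a∉ρ = unused-twin ρ x∈X
                 in a , extend R (inside a∈L b∈L) (compatible-fresh {ρ} {σ} a∉ρ b∉σ)

  isBackAndForth : IsBackAndForth G H X _≋_
  isBackAndForth = record
    { ≐-⇔   = λ R x∈X y∈X → Both-cong (related R x∈X) (related R y∈X) (sameEq R x∈X y∈X)
                                       (λ _ _ a≡c⇔b≡d → a≡c⇔b≡d)
    ; ∼-⇔   = λ R x∈X y∈X → Both-cong (related R x∈X) (related R y∈X) (sameEq R x∈X y∈X)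
                                       (λ a≈b c≈d a≡c⇔b≡d → T-cong (≈-adj a≈b c≈d a≡c⇔b≡d))
    ; forth = forth
    ; back  = back
    }
    where
    T-cong : ∀ {β γ} → β ≡ γ → T β ⇔ T γ
    T-cong β≡γ = mk⇔ (subst T β≡γ) (subst T (sym β≡γ))

⊨-twin-deletion : ∀ {m} (G : Graph (suc m)) (v : Fin (suc m)) (t : ℕ) → TwinClassSize G v t →
                  ∀ φ → numVars φ < t → G ⊨ φ ⇔ (G ─ v) ⊨ φ
⊨-twin-deletion G v _ (L , L! , L⇔twins , refl) φ |X|<|L| = Sat-⇔ φ (∈-deduplicate⁺ _≟_) []≋[]
  where
  open TwinDeletion G v L (to (L⇔twins _)) (from (L⇔twins v) (inj₁ refl)) L!
                    (deduplicate _≟_ (vars φ)) |X|<|L|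
  open IsBackAndForth isBackAndForth

lemma3 : ∀ {m} (G : Graph (suc m)) (v : Fin (suc m)) (t : ℕ) →
    TwinClassSize G v t →
    ∀ (φ : Formula) → Distinguishes φ G (G ─ v) → t ≤ numVars φ
lemma3 G v t twin-class φ distinguishes =
  ≮⇒≥ λ |φ|<t → ⇔⇒¬Distinguishes (⊨-twin-deletion G v t twin-class φ |φ|<t) distinguishes
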